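{- Let $n\geq 1$, let $U_{6n}=\langle a,b\mid a^{2n}=b^3=1,\ a^{ -1}ba=b^{ -1}\rangle$, and let $\Gamma=\Gamma(U_{6n})$ be its non-commuting graph. The set of distinct roots of the resolving polynomial $\beta(\Gamma,x)$ is $\{0,-2,-3\}$ when $n=1$, and $\{0,-n,-2n\}$ for all $n>1$.
   Context: The group $U_{6n}$ has order $6n$ and center $Z(U_{6n})=\langle a^2\rangle$. For a finite group $G$, the non-commuting graph $\Gamma(G)$ has vertex set $G\setminus Z(G)$, and two distinct vertices $x,y$ are adjacent iff $xy\neq yx$. For a connected graph $\Gamma$ with distance $d$, a set $W=\{w_1,\dots,w_k\}\subseteq V(\Gamma)$ is resolving if the vectors $(d(v,w_1),\dots,d(v,w_k))$, $v\in V(\Gamma)$, are pairwise distinct. The metric dimension $\beta(\Gamma)$ is the minimum size of a resolving set, and $\beta(\Gamma,x)=\sum_{i=\beta(\Gamma)}^{|V(\Gamma)|} r_i x^i$, where $r_i$ is the number of resolving sets of cardinality $i$. -}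

module Defs where

open import Level using (Level)
open import Data.Nat using (ℕ; zero; suc; _+_; _*_; NonZero; _%_; _<_)
open import Data.Nat.Properties using (m*n≢0)
open import Data.Nat.DivMod using (_mod_)
open import Data.Fin using (Fin; toℕ)
open import Data.Fin.Properties using (all?)
open import Data.Fin.Subset using (Subset; _∈_; ∣_∣)
open import Data.Product using (_×_; _,_; Σ; proj₁; proj₂)
open import Data.Product.Properties using (≡-dec)
open import Data.Sum using (_⊎_)
open import Data.List using (List; filter; cartesianProduct; allFin; length; lookup)
import Data.List.Membership.Propositional as ListMem
open import Data.List.Relation.Unary.Unique.Propositional using (Unique)
open import Data.Empty using (⊥)
open import Relation.Nullary using (¬_; Dec; ¬?)
open import Relation.Nullary.Decidable using (map′)
open import Relation.Unary using (Decidable)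
open import Relation.Binary.PropositionalEquality using (_≡_)
open import Function.Bundles using (_⇔_)
open import Algebra.Bundles using (CommutativeRing)
import Algebra.Bundles
import Algebra.Definitions.RawSemiring as RawSemiringDefs
import Data.Fin.Properties as FinP

-- The group U_{6n} = ⟨ a, b ∣ a^{2n} = b^3 = 1, a⁻¹ b a = b⁻¹ ⟩, n ≥ 1,
-- in normal form: the pair (i , j) stands for a^i b^j with
-- i ∈ ℤ/2n and j ∈ ℤ/3.  From a⁻¹ b a = b⁻¹ we get b^j a^k = a^k b^{(-1)^k j},
-- hence (a^i b^j)(a^k b^l) = a^{i+k} b^{(-1)^k j + l}; note (-1) ≡ 2 (mod 3).

U : (n : ℕ) → Set
U n = Fin (2 * n) × Fin 3

module _ (n : ℕ) .{{_ : NonZero n}} where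

  private
    instance
      nz2n : NonZero (2 * n)
      nz2n = m*n≢0 2 n

  mul : U n → U n → U n
  mul (i , j) (k , l) =
    ((toℕ i + toℕ k) mod (2 * n)) ,
    ((toℕ j * (1 + toℕ k % 2) + toℕ l) mod 3)

  elements : List (U n)
  elements = cartesianProduct (allFin (2 * n)) (allFin 3)

  Commute : U n → U n → Set
  Commute x y = mul x y ≡ mul y x

  commute? : ∀ x y → Dec (Commute x y)
  commute? x y = ≡-dec FinP._≟_ FinP._≟_ (mul x y) (mul y x)

  Central : U n → Set
  Central g = ∀ h → Commute g h

  central? : Decidable Central
  central? g = map′ (λ f h → f (proj₁ h) (proj₂ h)) (λ f i j → f (i , j))
    (all? (λ i → all? (λ j → commute? g (i , j))))

  vertices : List (U n)
  vertices = filter (λ g → ¬? (central? g)) elements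

  N : ℕ
  N = length vertices

  vertex : Fin N → U n
  vertex = lookup vertices

  -- adjacency in Γ(U_{6n}): x ~ y iff xy ≠ yx
  -- (this forces x ≠ y and x, y ∉ Z(G))
  Adj : U n → U n → Set
  Adj x y = ¬ Commute x y

  data Walk : ℕ → U n → U n → Set where
    here : ∀ {x} → Walk zero x x
    step : ∀ {k x y z} → Adj x y → Walk k y z → Walk (suc k) x z

  Dist : U n → U n → ℕ → Set
  Dist x y d = Walk d x y × (∀ k → k < d → ¬ Walk k x y)

  Resolving : Subset N → Set
  Resolving W = ∀ (u v : Fin N) →
    (∀ w → w ∈ W → ∀ d → Dist (vertex u) (vertex w) d ⇔ Dist (vertex v) (vertex w) d) →
    u ≡ v

  NumResolvingSets : ℕ → ℕ → Set
  NumResolvingSets i c =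
    Σ (List (Subset N)) λ L →
      Unique L × (∀ W → (W ListMem.∈ L) ⇔ (∣ W ∣ ≡ i × Resolving W)) × length L ≡ c

module _ {c ℓ : Level} (R : CommutativeRing c ℓ) where
  open CommutativeRing R using (Carrier; _≈_; 0#; 1#; -_; semiring)
    renaming (_+_ to _+ᴿ_; _*_ to _*ᴿ_)
  open RawSemiringDefs (Algebra.Bundles.Semiring.rawSemiring semiring) using (_^_) renaming (_×_ to _·ℕ_)

  evalPoly : (ℕ → ℕ) → ℕ → Carrier → Carrier
  evalPoly r zero x = r 0 ·ℕ 1#
  evalPoly r (suc m) x = evalPoly r m x +ᴿ (r (suc m) ·ℕ (x ^ suc m))

  ι : ℕ → Carrier
  ι k = k ·ℕ 1#

  IsCharZeroDomain : Set (c Level.⊔ ℓ)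
  IsCharZeroDomain =
    (¬ (1# ≈ 0#)) ×
    (∀ x y → x *ᴿ y ≈ 0# → x ≈ 0# ⊎ y ≈ 0#) ×
    (∀ k → ι k ≈ 0# → k ≡ 0)

  RootsAre : (Carrier → Carrier) → ℕ → ℕ → Set (c Level.⊔ ℓ)
  RootsAre p p₁ p₂ = ∀ x → (p x ≈ 0#) ⇔ (x ≈ 0# ⊎ x ≈ - ι p₁ ⊎ x ≈ - ι p₂)

-- The non-central elements of U₆ₙ commute exactly when they lie in the same one of four parts:
-- the 2n elements of ⟨a², b⟩ ∖ ⟨a²⟩ and the n elements of each coset a bʲ⟨a²⟩. So Γ is complete
-- multipartite, with distances 0, 1, 2. For n > 1 every part has two vertices, and a vertex set W
-- resolves Γ iff no part has two vertices outside W. Counting by the complement, there are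
-- e_{5n-i}(2n, n, n, n) resolving sets of size i (e_k elementary symmetric), hence
--   β(Γ, x) = x^{5n-4} Σⱼ e_{4-j} xʲ = x^{5n-4} (x + 2n)(x + n)³.
-- For n = 1 the parts a bʲ⟨a²⟩ are single vertices that nothing separates, so they act as one
-- part of size 3, and β(Γ, x) = x³ (x + 3)(x + 2). The roots are read off the factorisation in
-- any integral domain.

module Submission where

open import Algebra.Bundles using (CommutativeRing)
open import Data.Fin using (Fin)
open import Data.Nat using (ℕ)
open import Level using (Level)
open import Relation.Binary.Definitions using (DecidableEquality)

module ElementarySymmetric where

  open import Data.Bool using (Bool; true; false; T; if_then_else_)
  open import Data.Empty using (⊥-elim)
  open import Data.Fin using (Fin; zero; suc)
  open import Data.Fin.Properties using (_≟_)
  open import Data.Nat using (ℕ; zero; suc; _+_; _*_; _^_; _<_; s≤s)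
  open import Data.Nat.Properties using (+-commutativeSemigroup; +-identityʳ; *-zeroʳ; m<n⇒m<1+n)
  open import Data.Nat.Solver using (module +-*-Solver)
  open import Data.Product using (_×_; _,_)
  open import Data.Vec.Functional using (updateAt)
  open import Data.Vec.Functional.Properties using (updateAt-updates; updateAt-minimal)
  open import Function using (_∘_; const)
  open import Relation.Binary.PropositionalEquality
  open import Relation.Nullary using (yes; no)

  open import Algebra.Properties.CommutativeSemigroup +-commutativeSemigroup using (xy∙z≈xz∙y)
  open +-*-Solver using (solve; _:+_; _:*_; _:=_; con)

  -- esym b c k is the elementary symmetric polynomial e_k evaluated at the
  -- numbers c q of the labels q selected by b.
  esym : ∀ {m} → (Fin m → Bool) → (Fin m → ℕ) → ℕ → ℕ
  esym         b c zero    = 1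
  esym {zero}  b c (suc k) = 0
  esym {suc m} b c (suc k) =
    esym (b ∘ suc) (c ∘ suc) (suc k) + (if b zero then c zero * esym (b ∘ suc) (c ∘ suc) k else 0)

  esym-cong : ∀ {m} (b : Fin m → Bool) {c c′ : Fin m → ℕ} → (∀ q → c q ≡ c′ q) →
              ∀ k → esym b c k ≡ esym b c′ k
  esym-cong         b c≗c′ zero    = refl
  esym-cong {zero}  b c≗c′ (suc k) = refl
  esym-cong {suc m} b c≗c′ (suc k) =
    cong₂ (λ s t → s + (if b zero then t else 0))
      (esym-cong (b ∘ suc) (c≗c′ ∘ suc) (suc k))
      (cong₂ _*_ (c≗c′ zero) (esym-cong (b ∘ suc) (c≗c′ ∘ suc) k))

  esym-vanishes : ∀ {m} (b : Fin m → Bool) (c : Fin m → ℕ) {k} → m < k → esym b c k ≡ 0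
  esym-vanishes {zero}  b c {suc k} _ = refl
  esym-vanishes {suc m} b c {suc k} (s≤s m<k)
    rewrite esym-vanishes (b ∘ suc) (c ∘ suc) (m<n⇒m<1+n m<k)
          | esym-vanishes (b ∘ suc) (c ∘ suc) m<k
    with b zero
  ... | true  = *-zeroʳ (c zero)
  ... | false = refl

  esym-unselected-head : ∀ {m} (b : Fin (suc m) → Bool) c k → b zero ≡ false →
                         esym b c k ≡ esym (b ∘ suc) (c ∘ suc) k
  esym-unselected-head b c zero    _  = refl
  esym-unselected-head b c (suc k) b₀ rewrite b₀ = +-identityʳ _

  withdraw : ∀ {k} → (Fin k → Bool) → Fin k → Fin k → Bool
  withdraw b p = updateAt b p (const false)

  withdraw-selected : ∀ {k} (b : Fin k → Bool) p q → T (withdraw b p q) → T (b q) × q ≢ p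
  withdraw-selected b p q t with q ≟ p
  ... | yes refl = ⊥-elim (subst T (updateAt-updates p b) t)
  ... | no q≢p  = subst T (updateAt-minimal q p b q≢p) t , q≢p

  withdraw-keeps : ∀ {k} (b : Fin k → Bool) p q → T (b q) → q ≢ p → T (withdraw b p q)
  withdraw-keeps b p q t q≢p = subst T (sym (updateAt-minimal q p b q≢p)) t

  esym-increment : ∀ {m} (b : Fin m → Bool) (c : Fin m → ℕ) p k →
    esym b (updateAt c p suc) (suc k) ≡
    esym b c (suc k) + (if b p then esym (withdraw b p) c k else 0)
  esym-increment {suc m} b c zero k
    rewrite esym-unselected-head (withdraw b zero) c k refl
    with b zero
  ... | true  = solve 3 (λ s c₀ t → s :+ (t :+ c₀ :* t) := (s :+ c₀ :* t) :+ t) refl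
                  (esym (b ∘ suc) (c ∘ suc) (suc k)) (c zero) (esym (b ∘ suc) (c ∘ suc) k)
  ... | false = sym (+-identityʳ _)
  esym-increment {suc m} b c (suc p) zero
    rewrite esym-increment (b ∘ suc) (c ∘ suc) p zero =
      xy∙z≈xz∙y (esym (b ∘ suc) (c ∘ suc) 1) (if b (suc p) then 1 else 0) _
  esym-increment {suc m} b c (suc p) (suc k)
    rewrite esym-increment (b ∘ suc) (c ∘ suc) p (suc k)
          | esym-increment (b ∘ suc) (c ∘ suc) p k
    with b zero | b (suc p)
  ... | true  | true  =
    solve 5 (λ s t c₀ u v → (s :+ t) :+ c₀ :* (u :+ v) := (s :+ c₀ :* u) :+ (t :+ c₀ :* v)) refl s t (c zero) u v
    where
    s t u v : ℕ
    s = esym (b ∘ suc) (c ∘ suc) (suc (suc k))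
    t = esym (withdraw (b ∘ suc) p) (c ∘ suc) (suc k)
    u = esym (b ∘ suc) (c ∘ suc) (suc k)
    v = esym (withdraw (b ∘ suc) p) (c ∘ suc) k
  ... | true  | false = solve 3 (λ s c₀ u → (s :+ con 0) :+ c₀ :* (u :+ con 0) := (s :+ c₀ :* u) :+ con 0) refl
                          (esym (b ∘ suc) (c ∘ suc) (suc (suc k))) (c zero) (esym (b ∘ suc) (c ∘ suc) (suc k))
  ... | false | true  = solve 2 (λ s t → (s :+ t) :+ con 0 := (s :+ con 0) :+ (t :+ con 0)) refl
                          (esym (b ∘ suc) (c ∘ suc) (suc (suc k))) (esym (withdraw (b ∘ suc) p) (c ∘ suc) (suc k))
  ... | false | false = refl

  esym-const-zero : ∀ {m} (b : Fin m → Bool) k → esym b (const 0) (suc k) ≡ 0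
  esym-const-zero {zero}  b k = refl
  esym-const-zero {suc m} b k rewrite esym-const-zero (b ∘ suc) k with b zero
  ... | true  = refl
  ... | false = refl

  esym-scale : ∀ {m} (b : Fin m → Bool) (c : Fin m → ℕ) t k →
               esym b (λ q → t * c q) k ≡ t ^ k * esym b c k
  esym-scale         b c t zero    = refl
  esym-scale {zero}  b c t (suc k) = sym (*-zeroʳ (t ^ suc k))
  esym-scale {suc m} b c t (suc k)
    rewrite esym-scale (b ∘ suc) (c ∘ suc) t (suc k) | esym-scale (b ∘ suc) (c ∘ suc) t k
    with b zero
  ... | true  = solve 5 (λ t u c₀ e e′ → t :* u :* e′ :+ t :* c₀ :* (u :* e) := t :* u :* (e′ :+ c₀ :* e))
                  refl
                  t (t ^ k) (c zero) (esym (b ∘ suc) (c ∘ suc) k) (esym (b ∘ suc) (c ∘ suc) (suc k))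
  ... | false = solve 2 (λ v e′ → v :* e′ :+ con 0 := v :* (e′ :+ con 0)) refl
                  (t ^ suc k) (esym (b ∘ suc) (c ∘ suc) (suc k))

module Labelling where

  open ElementarySymmetric
  open import Data.Bool using (Bool; true; false; T; if_then_else_)
  open import Data.Empty using (⊥-elim)
  open import Data.Fin using (Fin; zero; suc)
  open import Data.Fin.Properties using (_≟_; all?; suc-injective; 0≢1+n)
  open import Data.Fin.Subset using (Subset; inside; outside; _∉_; ∁; ∣_∣)
  open import Data.Fin.Subset.Properties using (_∈?_; drop-there; drop-not-there; ∣∁p∣≡n∸∣p∣; ∣p∣≤n)
  open import Data.List using (List; []; _∷_; [_]; length; lookup; map; filter; _++_)
  open import Data.List.Membership.Propositional using () renaming (_∈_ to _∈ₗ_)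
  open import Data.List.Membership.Propositional.Properties
    using (∈-lookup; ∈-map⁺; ∈-map⁻; ∈-++⁺ˡ; ∈-++⁺ʳ; ∈-++⁻)
  open import Data.List.Membership.Propositional.Properties.WithK using (unique∧set⇒bag)
  open import Data.List.Properties using (length-++; length-map)
  open import Data.List.Relation.Binary.BagAndSetEquality using (∼bag⇒↭)
  open import Data.List.Relation.Binary.Permutation.Propositional.Properties using (↭-length)
  import Data.List.Relation.Unary.All as All
  open import Data.List.Relation.Unary.AllPairs using ([]; _∷_)
  open import Data.List.Relation.Unary.Any using (here)
  open import Data.List.Relation.Unary.Unique.Propositional using (Unique)
  import Data.List.Relation.Unary.Unique.Propositional.Properties as Unique
  open import Data.Nat using (ℕ; zero; suc; _+_; _∸_; _≤_; s≤s⁻¹)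
  open import Data.Nat.ListAction using (sum)
  open import Data.Nat.Properties using (+-suc; ∸-cancelˡ-≡)
  open import Data.Product using (_×_; _,_; proj₁; proj₂; ∃-syntax)
  open import Data.Sum using (inj₁; inj₂)
  open import Data.Unit using (⊤; tt)
  open import Data.Vec using ([]; _∷_; here)
  import Data.Vec as Vec
  open import Data.Vec.Functional using (updateAt; foldr)
  open import Data.Vec.Functional.Properties using (updateAt-updates; updateAt-minimal)
  open import Data.Vec.Properties using (∷-injectiveʳ)
  open import Function using (_∘_; const)
  open import Function.Bundles using (_⇔_; mk⇔; Equivalence)
  open import Relation.Binary.PropositionalEquality hiding ([_])
  open import Relation.Nullary using (¬_; ¬?; Dec; does; yes; no)
  open import Relation.Nullary.Decidable using (map′; _→-dec_)
  open import Relation.Unary using (Decidable)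

  indicator : ∀ {A : Set} → Dec A → ℕ
  indicator d = if does d then 1 else 0

  updateAt-suc : ∀ {m} (c : Fin m → ℕ) p q →
                 updateAt c p suc q ≡ indicator (p ≟ q) + c q
  updateAt-suc c zero    zero    = refl
  updateAt-suc c zero    (suc q) = refl
  updateAt-suc c (suc p) zero    = refl
  updateAt-suc c (suc p) (suc q) = updateAt-suc (c ∘ suc) p q

  foldr-+-zeros : ∀ m → foldr _+_ 0 (const {B = Fin m} 0) ≡ 0
  foldr-+-zeros zero    = refl
  foldr-+-zeros (suc m) = foldr-+-zeros m

  foldr-+-increment : ∀ {m} (c : Fin m → ℕ) p → foldr _+_ 0 (updateAt c p suc) ≡ suc (foldr _+_ 0 c)
  foldr-+-increment c zero    = refl
  foldr-+-increment c (suc p) = trans (cong (c zero +_) (foldr-+-increment (c ∘ suc) p)) (+-suc _ _)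

  lookup-injective : ∀ {A : Set} {xs : List A} → Unique xs → ∀ {u v} → lookup xs u ≡ lookup xs v → u ≡ v
  lookup-injective (x∉xs ∷ xs!) {zero}  {zero}  eq = refl
  lookup-injective (x∉xs ∷ xs!) {zero}  {suc v} eq = ⊥-elim (All.lookup x∉xs (∈-lookup v) eq)
  lookup-injective (x∉xs ∷ xs!) {suc u} {zero}  eq = ⊥-elim (All.lookup x∉xs (∈-lookup u) (sym eq))
  lookup-injective (x∉xs ∷ xs!) {suc u} {suc v} eq = cong suc (lookup-injective xs! eq)

  length-unique-≡ : ∀ {A : Set} {xs ys : List A} → Unique xs → Unique ys →
                    (∀ {z} → z ∈ₗ xs ⇔ z ∈ₗ ys) → length xs ≡ length ys
  length-unique-≡ xs! ys! xs≈ys = ↭-length (∼bag⇒↭ (unique∧set⇒bag xs! ys! xs≈ys))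

  ∈-if-true : ∀ {A : Set} {y : A} {ys β} → T β → y ∈ₗ ys → y ∈ₗ (if β then ys else [])
  ∈-if-true {β = true} _ y∈ys = y∈ys

  module Labelled {X : Set} {k : ℕ} (label : X → Fin k) where

    labelCount : List X → Fin k → ℕ
    labelCount []       = const 0
    labelCount (x ∷ xs) = updateAt (labelCount xs) (label x) suc

    length≡total-labelCount : ∀ xs → length xs ≡ foldr _+_ 0 (labelCount xs)
    length≡total-labelCount []       = sym (foldr-+-zeros k)
    length≡total-labelCount (x ∷ xs) =
      trans (cong suc (length≡total-labelCount xs)) (sym (foldr-+-increment (labelCount xs) (label x)))

    labelCount-filter : ∀ {P : X → Set} (P? : Decidable P) xs q →
      labelCount (filter P? xs) q ≡ sum (map (λ x → if does (P? x) then indicator (label x ≟ q) else 0) xs)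
    labelCount-filter P? []       q = refl
    labelCount-filter P? (x ∷ xs) q with does (P? x)
    ... | true  = trans (updateAt-suc (labelCount (filter P? xs)) (label x) q)
                        (cong (indicator (label x ≟ q) +_) (labelCount-filter P? xs q))
    ... | false = labelCount-filter P? xs q

    labelCount-positive : ∀ xs q → 1 ≤ labelCount xs q → ∃[ w ] label (lookup xs w) ≡ q
    labelCount-positive (x ∷ xs) q 1≤ with label x ≟ q
    ... | yes x∈q = zero , x∈q
    ... | no  x∉q =
      let w , w∈q = labelCount-positive xs q (subst (1 ≤_) (updateAt-minimal q (label x) _ (x∉q ∘ sym)) 1≤)
      in suc w , w∈q

    partner : ∀ xs u → 2 ≤ labelCount xs (label (lookup xs u)) →
              ∃[ u′ ] u′ ≢ u × label (lookup xs u′) ≡ label (lookup xs u)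
    partner (x ∷ xs) zero 2≤
      with w , w∈q ← labelCount-positive xs (label x) (s≤s⁻¹ (subst (2 ≤_) (updateAt-updates (label x) _) 2≤)) =
      suc w , (λ ()) , w∈q
    partner (x ∷ xs) (suc u) 2≤ with label x ≟ label (lookup xs u)
    ... | yes same = zero , (λ ()) , same
    ... | no  diff =
      let u′ , u′≢u , same =
            partner xs u (subst (2 ≤_) (updateAt-minimal _ (label x) _ (λ e → diff (sym e))) 2≤)
      in suc u′ , (λ e → u′≢u (suc-injective e)) , same

    DistinctLabelsOutside : (xs : List X) → Subset (length xs) → Set
    DistinctLabelsOutside xs W =
      ∀ {u v} → u ∉ W → v ∉ W → label (lookup xs u) ≡ label (lookup xs v) → u ≡ v

    distinctLabelsOutside? : ∀ xs W → Dec (DistinctLabelsOutside xs W)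
    distinctLabelsOutside? xs W = map′ (λ distinct {u} {v} → distinct u v) (λ distinct u v → distinct)
      (all? λ u → all? λ v →
        ¬? (u ∈? W) →-dec ¬? (v ∈? W) →-dec (label (lookup xs u) ≟ label (lookup xs v)) →-dec (u ≟ v))

    -- omissions xs b j lists the subsets of the positions of xs whose complement
    -- has j elements, carrying pairwise distinct labels selected by b.
    omissions : (xs : List X) → (Fin k → Bool) → ℕ → List (Subset (length xs))
    omittingHead : ∀ x xs → (Fin k → Bool) → ℕ → List (Subset (suc (length xs)))

    omissions []       b zero    = [ [] ]
    omissions []       b (suc j) = []
    omissions (x ∷ xs) b zero    = map (inside Vec.∷_) (omissions xs b zero)
    omissions (x ∷ xs) b (suc j) = map (inside Vec.∷_) (omissions xs b (suc j)) ++ omittingHead x xs b j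

    omittingHead x xs b j =
      if b (label x) then map (outside Vec.∷_) (omissions xs (withdraw b (label x)) j) else []

    Omits : (Fin k → Bool) → (xs : List X) → Subset (length xs) → Set
    Omits b []       []            = ⊤
    Omits b (x ∷ xs) (inside  ∷ W) = Omits b xs W
    Omits b (x ∷ xs) (outside ∷ W) = T (b (label x)) × Omits (withdraw b (label x)) xs W

    length-omissions : ∀ xs b j → length (omissions xs b j) ≡ esym b (labelCount xs) j
    length-omissions []       b zero    = refl
    length-omissions []       b (suc j) = sym (esym-const-zero b j)
    length-omissions (x ∷ xs) b zero    =
      trans (length-map (inside Vec.∷_) (omissions xs b zero)) (length-omissions xs b zero)
    length-omissions (x ∷ xs) b (suc j) = begin
      length (omissions (x ∷ xs) b (suc j))
        ≡⟨ length-++ (map (inside Vec.∷_) (omissions xs b (suc j))) ⟩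
      length (map (inside Vec.∷_) (omissions xs b (suc j))) + length (omittingHead x xs b j)
        ≡⟨ cong₂ _+_ (trans (length-map (inside Vec.∷_) (omissions xs b (suc j))) (length-omissions xs b (suc j)))
                     length-omittingHead ⟩
      esym b (labelCount xs) (suc j) + (if b (label x) then esym (withdraw b (label x)) (labelCount xs) j else 0)
        ≡⟨ esym-increment b (labelCount xs) (label x) j ⟨
      esym b (labelCount (x ∷ xs)) (suc j) ∎
      where
      open ≡-Reasoning
      length-omittingHead : length (omittingHead x xs b j) ≡
                            (if b (label x) then esym (withdraw b (label x)) (labelCount xs) j else 0)
      length-omittingHead with b (label x)
      ... | true  = trans (length-map (outside Vec.∷_) (omissions xs (withdraw b (label x)) j))
                          (length-omissions xs (withdraw b (label x)) j)
      ... | false = refl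

    private
      ∈-inside-omissions : ∀ x xs b j {W} →
                           W ∈ₗ omissions xs b j → (inside ∷ W) ∈ₗ omissions (x ∷ xs) b j
      ∈-inside-omissions x xs b zero    W∈ = ∈-map⁺ (inside Vec.∷_) W∈
      ∈-inside-omissions x xs b (suc j) W∈ = ∈-++⁺ˡ (∈-map⁺ (inside Vec.∷_) W∈)

    omissions⁺ : ∀ xs b W → Omits b xs W → W ∈ₗ omissions xs b ∣ ∁ W ∣
    omissions⁺ []       b []            _         = here refl
    omissions⁺ (x ∷ xs) b (inside  ∷ W) o         = ∈-inside-omissions x xs b ∣ ∁ W ∣ (omissions⁺ xs b W o)
    omissions⁺ (x ∷ xs) b (outside ∷ W) (bx , o) =
      ∈-++⁺ʳ (map (inside Vec.∷_) (omissions xs b (suc ∣ ∁ W ∣)))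
        (∈-if-true bx (∈-map⁺ (outside Vec.∷_) (omissions⁺ xs (withdraw b (label x)) W o)))

    omissions⁻ : ∀ xs b j W → W ∈ₗ omissions xs b j → ∣ ∁ W ∣ ≡ j × Omits b xs W
    omissions⁻ []       b zero    [] _ = refl , tt
    omissions⁻ (x ∷ xs) b zero    W W∈ with ∈-map⁻ (inside Vec.∷_) W∈
    ... | W′ , W′∈ , refl = omissions⁻ xs b zero W′ W′∈
    omissions⁻ (x ∷ xs) b (suc j) W W∈ with ∈-++⁻ (map (inside Vec.∷_) (omissions xs b (suc j))) W∈
    ... | inj₁ W∈ᵢ with ∈-map⁻ (inside Vec.∷_) W∈ᵢ
    ...   | W′ , W′∈ , refl = omissions⁻ xs b (suc j) W′ W′∈
    omissions⁻ (x ∷ xs) b (suc j) W W∈ | inj₂ W∈ₒ with b (label x) in bx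
    ... | true with ∈-map⁻ (outside Vec.∷_) W∈ₒ
    ...   | W′ , W′∈ , refl =
      let size , o = omissions⁻ xs (withdraw b (label x)) j W′ W′∈
      in cong suc size , subst T (sym bx) tt , o

    omissions-unique : ∀ xs b j → Unique (omissions xs b j)
    omissions-unique []       b zero    = All.[] ∷ []
    omissions-unique []       b (suc j) = []
    omissions-unique (x ∷ xs) b zero    = Unique.map⁺ ∷-injectiveʳ (omissions-unique xs b zero)
    omissions-unique (x ∷ xs) b (suc j) =
      Unique.++⁺ (Unique.map⁺ ∷-injectiveʳ (omissions-unique xs b (suc j))) omittingHead-unique disjoint
      where
      omittingHead-unique : Unique (omittingHead x xs b j)
      omittingHead-unique with b (label x)
      ... | true  = Unique.map⁺ ∷-injectiveʳ (omissions-unique xs (withdraw b (label x)) j)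
      ... | false = []
      disjoint : ∀ {V} → ¬ (V ∈ₗ map (inside Vec.∷_) (omissions xs b (suc j)) × V ∈ₗ omittingHead x xs b j)
      disjoint (V∈ᵢ , V∈ₒ) with ∈-map⁻ (inside Vec.∷_) V∈ᵢ | b (label x)
      ... | _ , _ , refl | true with () ← ∈-map⁻ (outside Vec.∷_) V∈ₒ

    Omits⇒selected : ∀ b xs W → Omits b xs W → ∀ {u} → u ∉ W → T (b (label (lookup xs u)))
    Omits⇒selected b (x ∷ xs) (inside  ∷ W) o        {zero}  u∉ = ⊥-elim (u∉ here)
    Omits⇒selected b (x ∷ xs) (inside  ∷ W) o        {suc u} u∉ = Omits⇒selected b xs W o (drop-not-there u∉)
    Omits⇒selected b (x ∷ xs) (outside ∷ W) (bx , o) {zero}  u∉ = bx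
    Omits⇒selected b (x ∷ xs) (outside ∷ W) (bx , o) {suc u} u∉ =
      proj₁ (withdraw-selected b (label x) _ (Omits⇒selected _ xs W o (drop-not-there u∉)))

    Omits⇒distinct : ∀ b xs W → Omits b xs W → DistinctLabelsOutside xs W
    Omits⇒distinct b (x ∷ xs) (inside ∷ W) o {zero}  {v}     u∉ v∉ eq = ⊥-elim (u∉ here)
    Omits⇒distinct b (x ∷ xs) (inside ∷ W) o {suc u} {zero}  u∉ v∉ eq = ⊥-elim (v∉ here)
    Omits⇒distinct b (x ∷ xs) (inside ∷ W) o {suc u} {suc v} u∉ v∉ eq =
      cong suc (Omits⇒distinct b xs W o (drop-not-there u∉) (drop-not-there v∉) eq)
    Omits⇒distinct b (x ∷ xs) (outside ∷ W) o        {zero}  {zero}  u∉ v∉ eq = refl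
    Omits⇒distinct b (x ∷ xs) (outside ∷ W) (bx , o) {zero}  {suc v} u∉ v∉ eq =
      ⊥-elim (proj₂ (withdraw-selected b (label x) _ (Omits⇒selected _ xs W o (drop-not-there v∉))) (sym eq))
    Omits⇒distinct b (x ∷ xs) (outside ∷ W) (bx , o) {suc u} {zero}  u∉ v∉ eq =
      ⊥-elim (proj₂ (withdraw-selected b (label x) _ (Omits⇒selected _ xs W o (drop-not-there u∉))) eq)
    Omits⇒distinct b (x ∷ xs) (outside ∷ W) (bx , o) {suc u} {suc v} u∉ v∉ eq =
      cong suc (Omits⇒distinct _ xs W o (drop-not-there u∉) (drop-not-there v∉) eq)

    Omits⁺ : ∀ b xs W → DistinctLabelsOutside xs W →
             (∀ {u} → u ∉ W → T (b (label (lookup xs u)))) → Omits b xs W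
    Omits⁺ b []       []            distinct selected = tt
    Omits⁺ b (x ∷ xs) (inside ∷ W)  distinct selected =
      Omits⁺ b xs W (λ u∉ v∉ eq → suc-injective (distinct (u∉ ∘ drop-there) (v∉ ∘ drop-there) eq))
                    (λ u∉ → selected (u∉ ∘ drop-there))
    Omits⁺ b (x ∷ xs) (outside ∷ W) distinct selected =
      selected {zero} (λ ()) ,
      Omits⁺ (withdraw b (label x)) xs W
        (λ u∉ v∉ eq → suc-injective (distinct (u∉ ∘ drop-there) (v∉ ∘ drop-there) eq))
        (λ {u} u∉ → withdraw-keeps b (label x) _ (selected (u∉ ∘ drop-there))
                      (λ eq → 0≢1+n (distinct (λ ()) (u∉ ∘ drop-there) (sym eq))))

    Omits-all⇔distinct : ∀ xs W → Omits (const true) xs W ⇔ DistinctLabelsOutside xs W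
    Omits-all⇔distinct xs W = mk⇔ (Omits⇒distinct _ xs W) (λ d → Omits⁺ _ xs W d (const tt))

    length-subsets-of-size : ∀ xs {P : Subset (length xs) → Set} →
      (∀ W → P W ⇔ DistinctLabelsOutside xs W) →
      ∀ {i} (L : List (Subset (length xs))) → Unique L → (∀ W → W ∈ₗ L ⇔ (∣ W ∣ ≡ i × P W)) →
      i ≤ length xs → length L ≡ esym (const true) (labelCount xs) (length xs ∸ i)
    length-subsets-of-size xs P⇔ {i} L L! L⇔ i≤m =
      trans (length-unique-≡ L! (omissions-unique xs (const true) (length xs ∸ i)) (mk⇔ into outof))
            (length-omissions xs (const true) (length xs ∸ i))
      where
      into : ∀ {W} → W ∈ₗ L → W ∈ₗ omissions xs (const true) (length xs ∸ i)
      into {W} W∈ =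
        let ∣W∣≡i , PW = Equivalence.to (L⇔ W) W∈
        in subst (λ j → W ∈ₗ omissions xs (const true) j)
                 (trans (∣∁p∣≡n∸∣p∣ W) (cong (length xs ∸_) ∣W∣≡i))
                 (omissions⁺ xs (const true) W (Equivalence.from (Omits-all⇔distinct xs W) (Equivalence.to (P⇔ W) PW)))
      outof : ∀ {W} → W ∈ₗ omissions xs (const true) (length xs ∸ i) → W ∈ₗ L
      outof {W} W∈ =
        let ∣∁W∣≡ , o = omissions⁻ xs (const true) (length xs ∸ i) W W∈
        in Equivalence.from (L⇔ W)
             ( ∸-cancelˡ-≡ (∣p∣≤n W) i≤m (trans (sym (∣∁p∣≡n∸∣p∣ W)) ∣∁W∣≡)
             , Equivalence.from (P⇔ W) (Equivalence.to (Omits-all⇔distinct xs W) o))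

module CompleteMultipartite {A : Set} (_≟ᴬ_ : DecidableEquality A) {k : ℕ} (part : A → Fin k) where

  open ElementarySymmetric
  open Labelling
  open import Data.Fin using (Fin)
  open import Data.Fin.Properties using (_≟_; all?)
  open import Data.Fin.Subset using (Subset; _∈_; _∉_)
  open import Data.Fin.Subset.Properties using (_∈?_)
  open import Data.List using (List; length; lookup)
  open import Data.List.Relation.Unary.Unique.Propositional using (Unique)
  import Data.Nat as ℕ
  open import Data.Nat using (ℕ; _≤_)
  open import Data.Product using (_,_)
  open import Function.Bundles using (_⇔_; mk⇔)
  open import Relation.Binary.PropositionalEquality
  open import Relation.Nullary using (Dec; yes; no; contradiction)
  open import Relation.Nullary.Decidable using (_→-dec_)

  open Labelled part

  distance : A → A → ℕ
  distance x y with x ≟ᴬ y | part x ≟ part y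
  ... | yes _ | _     = 0
  ... | no  _ | yes _ = 2
  ... | no  _ | no  _ = 1

  distance-refl : ∀ x → distance x x ≡ 0
  distance-refl x with x ≟ᴬ x
  ... | yes _   = refl
  ... | no  x≢x = contradiction refl x≢x

  distance≡0⇒≡ : ∀ {x y} → distance x y ≡ 0 → x ≡ y
  distance≡0⇒≡ {x} {y} d≡0 with x ≟ᴬ y | part x ≟ part y
  ... | yes x≡y | _     = x≡y
  ... | no  _   | yes _ with () ← d≡0
  ... | no  _   | no  _ with () ← d≡0

  distance-same-part : ∀ {x y} → x ≢ y → part x ≡ part y → distance x y ≡ 2
  distance-same-part {x} {y} x≢y same with x ≟ᴬ y | part x ≟ part y
  ... | yes x≡y | _       = contradiction x≡y x≢y
  ... | no  _   | yes _   = refl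
  ... | no  _   | no diff = contradiction same diff

  distance-other-part : ∀ {x y} → part x ≢ part y → distance x y ≡ 1
  distance-other-part {x} {y} diff with x ≟ᴬ y | part x ≟ part y
  ... | yes refl | _       = contradiction refl diff
  ... | no  _    | yes same = contradiction same diff
  ... | no  _    | no  _    = refl

  Resolves : (xs : List A) → Subset (length xs) → Set
  Resolves xs W = ∀ u v →
    (∀ w → w ∈ W → distance (lookup xs u) (lookup xs w) ≡ distance (lookup xs v) (lookup xs w)) → u ≡ v

  resolves? : ∀ xs W → Dec (Resolves xs W)
  resolves? xs W = all? λ u → all? λ v →
    (all? λ w → (w ∈? W) →-dec (distance (lookup xs u) (lookup xs w) ℕ.≟ distance (lookup xs v) (lookup xs w)))
    →-dec (u ≟ v)

  module _ {xs : List A} (xs! : Unique xs) (W : Subset (length xs)) where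

    private
      _≉_ : Fin (length xs) → Fin (length xs) → Set
      u ≉ w = lookup xs u ≢ lookup xs w

      ∉-≉-∈ : ∀ {u w} → u ∉ W → w ∈ W → u ≉ w
      ∉-≉-∈ u∉ w∈ eq = u∉ (subst (_∈ W) (sym (lookup-injective xs! eq)) w∈)

    resolves⇒distinct : Resolves xs W → DistinctLabelsOutside xs W
    resolves⇒distinct resolves {u} {v} u∉ v∉ same = resolves u v equidistant
      where
      equidistant : ∀ w → w ∈ W → distance (lookup xs u) (lookup xs w) ≡ distance (lookup xs v) (lookup xs w)
      equidistant w w∈ = compare (part (lookup xs u) ≟ part (lookup xs w))
        where
        compare : Dec (part (lookup xs u) ≡ part (lookup xs w)) →
                  distance (lookup xs u) (lookup xs w) ≡ distance (lookup xs v) (lookup xs w)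
        compare (yes u~w) = trans (distance-same-part (∉-≉-∈ u∉ w∈) u~w)
                                  (sym (distance-same-part (∉-≉-∈ v∉ w∈) (trans (sym same) u~w)))
        compare (no  u≁w) = trans (distance-other-part u≁w)
                                  (sym (distance-other-part (λ v~w → u≁w (trans same v~w))))

    -- When every part has a second vertex, two unresolved vertices in different parts
    -- are separated by the partner of one of them, which must lie in W.
    resolves⇐distinct : (∀ q → 2 ≤ labelCount xs q) → DistinctLabelsOutside xs W → Resolves xs W
    resolves⇐distinct two distinct u v equidistant with u ∈? W | v ∈? W
    ... | yes u∈ | _ = sym (lookup-injective xs! (distance≡0⇒≡ (trans (sym (equidistant u u∈)) (distance-refl _))))
    ... | no  _  | yes v∈ = lookup-injective xs! (distance≡0⇒≡ (trans (equidistant v v∈) (distance-refl _)))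
    ... | no  u∉ | no v∉ with part (lookup xs u) ≟ part (lookup xs v)
    ...   | yes same = distinct u∉ v∉ same
    ...   | no  diff with partner xs u (two _)
    ...     | u′ , u′≢u , u′~u with u′ ∈? W
    ...       | no  u′∉ = contradiction (distinct u′∉ u∉ u′~u) u′≢u
    ...       | yes u′∈ = contradiction
                (trans (sym (distance-same-part (λ eq → u′≢u (sym (lookup-injective xs! eq))) (sym u′~u)))
                       (trans (equidistant u′ u′∈)
                              (distance-other-part (λ v~u′ → diff (trans (sym u′~u) (sym v~u′))))))
                λ ()

    resolves⇔distinct : (∀ q → 2 ≤ labelCount xs q) → Resolves xs W ⇔ DistinctLabelsOutside xs W
    resolves⇔distinct two = mk⇔ resolves⇒distinct (resolves⇐distinct two)

module NonCommutingGraph where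

  open import Defs
  open ElementarySymmetric
  open Labelling
  open import Data.Bool using (Bool; true; false; T; _∨_)
  import Data.Bool as Bool
  open import Data.Bool.Properties using (T-∨)
  open import Data.Fin using (Fin; zero; suc; toℕ; fromℕ<)
  open import Data.Fin.Properties using (_≟_; all?; toℕ-fromℕ<)
  open import Data.List.Membership.Propositional.Properties using (∈-filter⁻; ∈-lookup)
  open import Data.List.Relation.Unary.Unique.Propositional using (Unique)
  import Data.List.Relation.Unary.Unique.Propositional.Properties as Unique
  open import Data.Nat using (ℕ; zero; suc; _+_; _*_; _%_; _<_; s≤s; NonZero; >-nonZero⁻¹; z<s)
  open import Data.Nat.DivMod using (_mod_; m%n<n)
  open import Data.Nat.Properties using (+-comm; *-monoʳ-≤; m*n≢0; <-trans; <-cmp)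
  open import Data.Product using (_,_; proj₁; proj₂)
  open import Data.Product.Properties using (≡-dec)
  open import Data.Sum using (inj₁)
  open import Data.Unit using (tt)
  open import Function.Bundles using (_⇔_; mk⇔; Equivalence)
  open import Relation.Binary.Definitions using (tri<; tri≈; tri>)
  open import Relation.Binary.PropositionalEquality
  open import Relation.Nullary using (¬_; ¬?; Dec; yes; no; contradiction)
  open import Relation.Nullary.Decidable using (isYes; toWitness; fromWitness)

  parity : ∀ {m} → Fin m → ℕ
  parity i = toℕ i % 2

  -- The centre is ⟨a²⟩ (i even, j = 0). A non-central a^i b^j lies in part 0, the rest of the
  -- abelian subgroup ⟨a², b⟩, if i is even, and in the coset a b^j ⟨a²⟩, part 1 + j, if i is odd.
  partOf : ℕ → Fin 3 → Fin 4
  partOf zero    j = zero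
  partOf (suc _) j = suc j

  centralOf : ℕ → Fin 3 → Bool
  centralOf zero zero = true
  centralOf _    _    = false

  -- the b-exponent of (a^i b^j)(a^k b^l) when k has parity p
  twist : ℕ → Fin 3 → Fin 3 → Fin 3
  twist p j l = (toℕ j * (1 + p) + toℕ l) mod 3

  commutesOf : ℕ → ℕ → Fin 3 → Fin 3 → Bool
  commutesOf p q j l = centralOf p j ∨ centralOf q l ∨ isYes (partOf p j ≟ partOf q l)

  commutation-table : ∀ p q → p < 2 → q < 2 → ∀ j l →
                      isYes (twist q j l ≟ twist p l j) ≡ commutesOf p q j l
  commutation-table p q p<2 q<2 = toWitness {a? = table? p q} (by-evaluation p q p<2 q<2)
    where
    table? : ∀ p q → Dec (∀ j l → isYes (twist q j l ≟ twist p l j) ≡ commutesOf p q j l)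
    table? p q = all? λ j → all? λ l → isYes (twist q j l ≟ twist p l j) Bool.≟ commutesOf p q j l
    by-evaluation : ∀ p q → p < 2 → q < 2 → T (isYes (table? p q))
    by-evaluation 0 0 _ _ = tt
    by-evaluation 0 1 _ _ = tt
    by-evaluation 1 0 _ _ = tt
    by-evaluation 1 1 _ _ = tt
    by-evaluation (suc (suc _)) _             (s≤s (s≤s ())) _
    by-evaluation 0             (suc (suc _)) _              (s≤s (s≤s ()))
    by-evaluation 1             (suc (suc _)) _              (s≤s (s≤s ()))

  ∨-false : ∀ {β γ δ} → β ≡ false → γ ≡ false → T (β ∨ γ ∨ δ) → T δ
  ∨-false refl refl t = t

  module _ (n : ℕ) .{{_ : NonZero n}} where

    walk-length-0 : ∀ {x y} → Walk n 0 x y → x ≡ y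
    walk-length-0 here = refl

    walk-length-1 : ∀ {x y} → Walk n 1 x y → Adj n x y
    walk-length-1 (step x~y here) = x~y

    shortest-walk : ∀ {x y D} → Walk n D x y → (∀ k → k < D → ¬ Walk n k x y) →
                    ∀ d → Dist n x y d ⇔ d ≡ D
    shortest-walk {D = D} walk shortest d = mk⇔ to (λ { refl → walk , shortest })
      where
      to : Dist n _ _ d → d ≡ D
      to (walk′ , shortest′) with <-cmp d D
      ... | tri< d<D _ _ = contradiction walk′ (shortest d d<D)
      ... | tri≈ _ d≡D _ = d≡D
      ... | tri> _ _ D<d = contradiction walk (shortest′ D D<d)

  module Group (n : ℕ) .{{_ : NonZero n}} where

    part : U n → Fin 4
    part (i , j) = partOf (parity i) j

    centralᵇ : U n → Bool
    centralᵇ (i , j) = centralOf (parity i) j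

    private
      instance
        2n≢0 : NonZero (2 * n)
        2n≢0 = m*n≢0 2 n

      parity<2 : ∀ {m} (i : Fin m) → parity i < 2
      parity<2 i = m%n<n (toℕ i) 2

      1<2n : 1 < 2 * n
      1<2n = *-monoʳ-≤ 2 (>-nonZero⁻¹ n)

    commute⇔ : ∀ x y → Commute n x y ⇔ T (centralᵇ x ∨ centralᵇ y ∨ isYes (part x ≟ part y))
    commute⇔ (i , j) (k , l) = mk⇔
      (λ xy≡yx → subst T table (fromWitness (cong proj₂ xy≡yx)))
      (λ t → cong₂ _,_ (cong (_mod (2 * n)) (+-comm (toℕ i) (toℕ k)))
                       (toWitness (subst T (sym table) t)))
      where
      table : isYes (twist (parity k) j l ≟ twist (parity i) l j) ≡ commutesOf (parity i) (parity k) j l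
      table = commutation-table (parity i) (parity k) (parity<2 i) (parity<2 k) j l

    NonCentral : U n → Set
    NonCentral x = centralᵇ x ≡ false

    noncentral-commute⇔ : ∀ x y → NonCentral x → NonCentral y → Commute n x y ⇔ part x ≡ part y
    noncentral-commute⇔ x y nx ny = mk⇔
      (λ xy≡yx → toWitness (∨-false nx ny (Equivalence.to (commute⇔ x y) xy≡yx)))
      (λ same → Equivalence.from (commute⇔ x y)
                  (subst₂ (λ β γ → T (β ∨ γ ∨ isYes (part x ≟ part y))) (sym nx) (sym ny) (fromWitness same)))

    adjacent : ∀ x y → NonCentral x → NonCentral y → part x ≢ part y → Adj n x y
    adjacent x y nx ny diff xy≡yx = diff (Equivalence.to (noncentral-commute⇔ x y nx ny) xy≡yx)

    a b : U n
    a = fromℕ< 1<2n , zero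
    b = fromℕ< (<-trans z<s 1<2n) , suc zero

    private
      parity-a : parity (proj₁ a) ≡ 1
      parity-a = cong (_% 2) (toℕ-fromℕ< 1<2n)

      parity-b : parity (proj₁ b) ≡ 0
      parity-b = cong (_% 2) (toℕ-fromℕ< (<-trans z<s 1<2n))

    a-noncentral : NonCentral a
    a-noncentral = cong (λ p → centralOf p zero) parity-a

    b-noncentral : NonCentral b
    b-noncentral = cong (λ p → centralOf p (suc zero)) parity-b

    part-a : part a ≡ suc zero
    part-a = cong (λ p → partOf p zero) parity-a

    part-b : part b ≡ zero
    part-b = cong (λ p → partOf p (suc zero)) parity-b

    central⇔ : ∀ x → Central n x ⇔ T (centralᵇ x)
    central⇔ x = mk⇔ to (λ t y → Equivalence.from (commute⇔ x y) (Equivalence.from T-∨ (inj₁ t)))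
      where
      to : Central n x → T (centralᵇ x)
      to central with centralᵇ x in nx
      ... | true  = tt
      ... | false = contradiction
                      (trans (sym part-a) (trans (sym (same a a-noncentral)) (trans (same b b-noncentral) part-b)))
                                  (λ ())
        where
        same : ∀ g → NonCentral g → part x ≡ part g
        same g ng = Equivalence.to (noncentral-commute⇔ x g nx ng) (central g)

    noncentral : ∀ {x} → ¬ Central n x → NonCentral x
    noncentral {x} ¬central with centralᵇ x in cx
    ... | true  = contradiction (Equivalence.from (central⇔ x) (subst T (sym cx) tt)) ¬central
    ... | false = refl

    open CompleteMultipartite (≡-dec _≟_ _≟_) part public

    private
      outsider : Fin 4 → U n
      outsider zero    = a
      outsider (suc _) = b

      outsider-noncentral : ∀ q → NonCentral (outsider q)
      outsider-noncentral zero    = a-noncentral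
      outsider-noncentral (suc _) = b-noncentral

      part-outsider : ∀ q → part (outsider q) ≢ q
      part-outsider zero    eq with () ← trans (sym part-a) eq
      part-outsider (suc q) eq with () ← trans (sym part-b) eq

    distance-in-Γ : ∀ x y → NonCentral x → NonCentral y → ∀ d → Dist n x y d ⇔ d ≡ distance x y
    distance-in-Γ x y nx ny d = by-cases (≡-dec _≟_ _≟_ x y) (part x ≟ part y)
      where
      by-cases : Dec (x ≡ y) → Dec (part x ≡ part y) → Dist n x y d ⇔ d ≡ distance x y
      by-cases (yes refl) _ =
        subst (λ D → Dist n x y d ⇔ d ≡ D) (sym (distance-refl x)) (shortest-walk n here (λ _ ()) d)
      by-cases (no x≢y) (yes same) =
        subst (λ D → Dist n x y d ⇔ d ≡ D) (sym (distance-same-part x≢y same))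
          (shortest-walk n (step x~z (step z~y here)) no-shorter d)
        where
        z : U n
        z = outsider (part x)
        x~z : Adj n x z
        x~z = adjacent x z nx (outsider-noncentral (part x)) (λ eq → part-outsider (part x) (sym eq))
        z~y : Adj n z y
        z~y = adjacent z y (outsider-noncentral (part x)) ny (λ eq → part-outsider (part x) (trans eq (sym same)))
        no-shorter : ∀ k → k < 2 → ¬ Walk n k x y
        no-shorter 0 _ w = x≢y (walk-length-0 n w)
        no-shorter 1 _ w = walk-length-1 n w (Equivalence.from (noncentral-commute⇔ x y nx ny) same)
        no-shorter (suc (suc _)) (s≤s (s≤s ()))
      by-cases (no x≢y) (no diff) =
        subst (λ D → Dist n x y d ⇔ d ≡ D) (sym (distance-other-part diff))
          (shortest-walk n (step (adjacent x y nx ny diff) here) no-shorter d)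
        where
        no-shorter : ∀ k → k < 1 → ¬ Walk n k x y
        no-shorter 0 _ w = x≢y (walk-length-0 n w)
        no-shorter (suc _) (s≤s ())

    vertex-noncentral : ∀ u → NonCentral (vertex n u)
    vertex-noncentral u =
      noncentral (proj₂ (∈-filter⁻ (λ g → ¬? (central? n g)) {xs = elements n} (∈-lookup u)))

    vertices-unique : Unique (vertices n)
    vertices-unique = Unique.filter⁺ (λ g → ¬? (central? n g))
      (Unique.cartesianProduct⁺ (Unique.allFin⁺ (2 * n)) (Unique.allFin⁺ 3))

    resolving⇔resolves : ∀ W → Resolving n W ⇔ Resolves (vertices n) W
    resolving⇔resolves W = mk⇔
      (λ resolving u v same → resolving u v λ w w∈ d →
        mk⇔ (λ du → Equivalence.from (dist v w d) (trans (Equivalence.to (dist u w d) du) (same w w∈)))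
            (λ dv → Equivalence.from (dist u w d) (trans (Equivalence.to (dist v w d) dv) (sym (same w w∈)))))
      (λ resolves u v same → resolves u v λ w w∈ →
        Equivalence.to (dist v w _) (Equivalence.to (same w w∈ _) (Equivalence.from (dist u w _) refl)))
      where
      dist : ∀ u w d → Dist n (vertex n u) (vertex n w) d ⇔ d ≡ distance (vertex n u) (vertex n w)
      dist u w = distance-in-Γ _ _ (vertex-noncentral u) (vertex-noncentral w)

module PartSizes where

  open import Defs
  open ElementarySymmetric
  open Labelling
  open NonCommutingGraph
  open import Data.Bool using (false; T; if_then_else_)
  import Data.Bool as Bool
  open import Data.Fin using (Fin; zero; suc; toℕ)
  open import Data.Fin.Properties using (_≟_)
  open import Data.List using ([]; _∷_; _++_; length; map; filter; tabulate; cartesianProduct; allFin)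
  open import Data.List.Properties using (map-tabulate; map-++; map-∘; filter-≐)
  open import Data.Nat using (ℕ; zero; suc; _+_; _*_; _%_; NonZero)
  open import Data.Nat.DivMod using ([m+n]%n≡m%n)
  open import Data.Nat.ListAction using (sum)
  open import Data.Nat.ListAction.Properties using (sum-++)
  open import Data.Nat.Properties using (+-comm; *-suc)
  open import Data.Nat.Solver using (module +-*-Solver)
  open import Data.Product using (_×_; _,_)
  open import Data.Vec.Functional using (foldr)
  open import Function using (_∘_)
  open import Function.Bundles using (Equivalence)
  open import Relation.Binary.PropositionalEquality
  open import Relation.Nullary using (does; ¬?)
  open import Relation.Unary using (Decidable)

  open +-*-Solver using (solve; _:+_; _:*_; _:=_; con)

  sum-cartesianProduct : ∀ {A B : Set} (f : A × B → ℕ) xs ys →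
    sum (map f (cartesianProduct xs ys)) ≡ sum (map (λ x → sum (map (λ y → f (x , y)) ys)) xs)
  sum-cartesianProduct f []       ys = refl
  sum-cartesianProduct f (x ∷ xs) ys = begin
    sum (map f (map (x ,_) ys ++ cartesianProduct xs ys))
      ≡⟨ cong sum (map-++ f (map (x ,_) ys) (cartesianProduct xs ys)) ⟩
    sum (map f (map (x ,_) ys) ++ map f (cartesianProduct xs ys))
      ≡⟨ sum-++ (map f (map (x ,_) ys)) (map f (cartesianProduct xs ys)) ⟩
    sum (map f (map (x ,_) ys)) + sum (map f (cartesianProduct xs ys))
      ≡⟨ cong₂ _+_ (cong sum (sym (map-∘ ys))) (sum-cartesianProduct f xs ys) ⟩
    sum (map (λ y → f (x , y)) ys) + sum (map (λ x → sum (map (λ y → f (x , y)) ys)) xs) ∎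
    where open ≡-Reasoning

  sum-tabulate-periodic : ∀ n (f : ℕ → ℕ) → (∀ i → f (2 + i) ≡ f i) →
                          sum (tabulate {n = 2 * n} (f ∘ toℕ)) ≡ n * (f 0 + f 1)
  sum-tabulate-periodic zero    f periodic = refl
  sum-tabulate-periodic (suc n) f periodic = begin
    sum (tabulate {n = 2 * suc n} (f ∘ toℕ))
      ≡⟨ cong (λ m → sum (tabulate {n = m} (f ∘ toℕ))) (*-suc 2 n) ⟩
    f 0 + (f 1 + sum (tabulate {n = 2 * n} (f ∘ (2 +_) ∘ toℕ)))
      ≡⟨ cong (λ s → f 0 + (f 1 + s)) (sum-tabulate-periodic n (f ∘ (2 +_)) (periodic ∘ (2 +_))) ⟩
    f 0 + (f 1 + n * (f 2 + f 3))
      ≡⟨ cong (λ s → f 0 + (f 1 + n * s)) (cong₂ _+_ (periodic 0) (periodic 1)) ⟩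
    f 0 + (f 1 + n * (f 0 + f 1))
      ≡⟨ solve 3 (λ a b n → a :+ (b :+ n :* (a :+ b)) := (a :+ b) :+ n :* (a :+ b)) refl (f 0) (f 1) n ⟩
    suc n * (f 0 + f 1) ∎
    where open ≡-Reasoning

  partShape : Fin 4 → ℕ
  partShape zero    = 2
  partShape (suc _) = 1

  module Sizes (n : ℕ) .{{_ : NonZero n}} where
    open Group n
    open Labelled part

    private
      noncentral? : Decidable NonCentral
      noncentral? x = centralᵇ x Bool.≟ false

      vertices≡ : vertices n ≡ filter noncentral? (elements n)
      vertices≡ = filter-≐ (λ g → ¬? (central? n g)) noncentral?
        (noncentral , λ nc c → subst T nc (Equivalence.to (central⇔ _) c)) (elements n)

      rowWeight : ℕ → Fin 4 → ℕ
      rowWeight p q =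
        sum (map (λ j → if does (centralOf p j Bool.≟ false) then indicator (partOf p j ≟ q) else 0) (allFin 3))

      rowWeights : ∀ q → rowWeight 0 q + rowWeight 1 q ≡ partShape q
      rowWeights zero                   = refl
      rowWeights (suc zero)             = refl
      rowWeights (suc (suc zero))       = refl
      rowWeights (suc (suc (suc zero))) = refl

    labelCount-vertices : ∀ q → labelCount (vertices n) q ≡ n * partShape q
    labelCount-vertices q = begin
      labelCount (vertices n) q
        ≡⟨ cong (λ xs → labelCount xs q) vertices≡ ⟩
      labelCount (filter noncentral? (elements n)) q
        ≡⟨ labelCount-filter noncentral? (elements n) q ⟩
      sum (map weight (elements n))
        ≡⟨ sum-cartesianProduct weight (allFin (2 * n)) (allFin 3) ⟩
      sum (map (λ i → rowWeight (parity i) q) (allFin (2 * n)))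
        ≡⟨ cong sum (map-tabulate {n = 2 * n} (λ i → i) (λ i → rowWeight (parity i) q)) ⟩
      sum (tabulate {n = 2 * n} (λ i → rowWeight (toℕ i % 2) q))
        ≡⟨ sum-tabulate-periodic n (λ m → rowWeight (m % 2) q)
             (λ m → cong (λ p → rowWeight p q) (trans (cong (_% 2) (+-comm 2 m)) ([m+n]%n≡m%n m 2))) ⟩
      n * (rowWeight 0 q + rowWeight 1 q)
        ≡⟨ cong (n *_) (rowWeights q) ⟩
      n * partShape q ∎
      where
      open ≡-Reasoning
      weight : U n → ℕ
      weight x = if does (noncentral? x) then indicator (part x ≟ q) else 0

    vertex-count : N n ≡ 5 * n
    vertex-count = begin
      length (vertices n)
        ≡⟨ length≡total-labelCount (vertices n) ⟩
      foldr _+_ 0 (labelCount (vertices n))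
        ≡⟨ cong₂ _+_ (labelCount-vertices zero) (cong₂ _+_ (labelCount-vertices (suc zero))
             (cong₂ _+_ (labelCount-vertices (suc (suc zero))) (cong (_+ 0) (labelCount-vertices (suc (suc (suc zero))))))) ⟩
      n * 2 + (n * 1 + (n * 1 + (n * 1 + 0)))
        ≡⟨ solve 1 (λ n → n :* con 2 :+ (n :* con 1 :+ (n :* con 1 :+ (n :* con 1 :+ con 0))) := con 5 :* n) refl n ⟩
      5 * n ∎
      where open ≡-Reasoning

module Polynomial {c ℓ : Level} (R : CommutativeRing c ℓ) where

  open import Defs
  open ElementarySymmetric
  import Algebra.Bundles
  import Algebra.Definitions.RawSemiring as RawSemiringDefs
  open import Data.Bool using (true)
  open import Data.Fin using (Fin)
  open import Data.Nat using (ℕ; zero; suc; _∸_; _≤_; z≤n; s≤s)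
    renaming (_+_ to _+ℕ_; _*_ to _*ℕ_; _^_ to _^ℕ_)
  import Data.Nat.Properties as ℕ
  open import Data.Sum using (_⊎_; inj₁; inj₂)
  open import Function using (const)
  open import Function.Bundles using (_⇔_; mk⇔)
  open import Relation.Binary.PropositionalEquality as ≡ using (_≡_)

  open CommutativeRing R
  open RawSemiringDefs (Algebra.Bundles.Semiring.rawSemiring semiring) using (_^_) renaming (_×_ to _·_)
  open import Algebra.Properties.Group +-group using (inverseˡ-unique)
  open import Algebra.Properties.Semiring.Exp semiring using (^-homo-*; ^-congʳ; ^-congˡ)
  open import Algebra.Properties.Semiring.Mult semiring using (×-assoc-*; ×-comm-*; ×1-homo-*; ×-congʳ)
  open import Algebra.Properties.Semiring.Mult.TCOptimised semiring using (×ᵤ≈×) renaming (_×_ to _×′_)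
  open import Algebra.Solver.Ring.NaturalCoefficients.Default commutativeSemiring
  open import Relation.Binary.Reasoning.Setoid setoid

  ·≈ι* : ∀ k y → k · y ≈ ι R k * y
  ·≈ι* k y = sym (trans (×-assoc-* k 1# y) (×-congʳ k (*-identityˡ y)))

  evalPoly-cong : ∀ {r s : ℕ → ℕ} k → (∀ j → j ≤ k → r j ≡ s j) →
                  ∀ x → evalPoly R r k x ≡ evalPoly R s k x
  evalPoly-cong zero    r≗s x = ≡.cong (_· 1#) (r≗s 0 z≤n)
  evalPoly-cong (suc k) r≗s x =
    ≡.cong₂ _+_ (evalPoly-cong k (λ j j≤k → r≗s j (ℕ.m≤n⇒m≤1+n j≤k)) x)
                (≡.cong (_· (x ^ suc k)) (r≗s (suc k) ℕ.≤-refl))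

  evalPoly-zeros : ∀ r m x → (∀ i → i ≤ m → r i ≡ 0) → evalPoly R r m x ≈ 0#
  evalPoly-zeros r zero    x zeros rewrite zeros 0 z≤n = refl
  evalPoly-zeros r (suc m) x zeros rewrite zeros (suc m) ℕ.≤-refl =
    trans (+-identityʳ _) (evalPoly-zeros r m x (λ i i≤m → zeros i (ℕ.m≤n⇒m≤1+n i≤m)))

  evalPoly-shift : ∀ r m x → (∀ i → i ≤ m → r i ≡ 0) → ∀ k →
    evalPoly R r (k +ℕ suc m) x ≈ x ^ suc m * evalPoly R (λ j → r (j +ℕ suc m)) k x
  evalPoly-shift r m x zeros zero = begin
    evalPoly R r m x + r (suc m) · x ^ suc m  ≈⟨ +-congʳ (evalPoly-zeros r m x zeros) ⟩
    0# + r (suc m) · x ^ suc m                ≈⟨ +-identityˡ _ ⟩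
    r (suc m) · x ^ suc m                     ≈⟨ ×-congʳ (r (suc m)) (*-identityʳ _) ⟨
    r (suc m) · (x ^ suc m * 1#)              ≈⟨ ×-comm-* (r (suc m)) (x ^ suc m) 1# ⟨
    x ^ suc m * (r (suc m) · 1#)              ∎
  evalPoly-shift r m x zeros (suc k) = begin
    evalPoly R r (k +ℕ suc m) x + a · x ^ (suc k +ℕ suc m)
      ≈⟨ +-cong (evalPoly-shift r m x zeros k)
                (×-congʳ a (trans (^-congʳ x (ℕ.+-comm (suc k) (suc m))) (^-homo-* x (suc m) (suc k)))) ⟩
    x ^ suc m * P + a · (x ^ suc m * x ^ suc k)
      ≈⟨ +-congˡ (×-comm-* a (x ^ suc m) (x ^ suc k)) ⟨
    x ^ suc m * P + x ^ suc m * (a · x ^ suc k)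
      ≈⟨ distribˡ (x ^ suc m) P (a · x ^ suc k) ⟨
    x ^ suc m * (P + a · x ^ suc k) ∎
    where
    a : ℕ
    a = r (suc k +ℕ suc m)
    P : Carrier
    P = evalPoly R (λ j → r (j +ℕ suc m)) k x

  -- The coefficients r i = e_{N-i} with i ≤ m vanish as there are only K labels.
  evalPoly-complementary-esym : ∀ {K} (c : Fin K → ℕ) m r →
    (∀ i → i ≤ K +ℕ suc m → r i ≡ esym (const true) c (K +ℕ suc m ∸ i)) → ∀ x →
    evalPoly R r (K +ℕ suc m) x ≈ x ^ suc m * evalPoly R (λ j → esym (const true) c (K ∸ j)) K x
  evalPoly-complementary-esym {K} c m r coefficient x =
    trans (evalPoly-shift r m x vanishing K) (*-congˡ (reflexive (evalPoly-cong K top x)))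
    where
    vanishing : ∀ i → i ≤ m → r i ≡ 0
    vanishing i i≤m = ≡.trans (coefficient i (ℕ.≤-trans (ℕ.m≤n⇒m≤1+n i≤m) (ℕ.m≤n+m (suc m) K)))
      (esym-vanishes (const true) c
        (ℕ.≤-trans (ℕ.≤-reflexive (ℕ.+-comm 1 K))
          (ℕ.≤-trans (ℕ.+-monoʳ-≤ K (s≤s z≤n)) (ℕ.≤-reflexive (≡.sym (≡.trans (ℕ.+-∸-assoc K (ℕ.m≤n⇒m≤1+n i≤m))
                                                               (≡.cong (K +ℕ_) (ℕ.+-∸-assoc 1 i≤m))))))))
    top : ∀ j → j ≤ K → r (j +ℕ suc m) ≡ esym (const true) c (K ∸ j)
    top j j≤K = ≡.trans (coefficient (j +ℕ suc m) (ℕ.+-monoˡ-≤ (suc m) j≤K))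
      (≡.cong (esym (const true) c)
        (≡.trans (≡.cong₂ _∸_ (ℕ.+-comm K (suc m)) (ℕ.+-comm j (suc m))) (ℕ.[m+n]∸[m+o]≡n∸o (suc m) K j)))

  module _ (domain : ∀ a b → a * b ≈ 0# → a ≈ 0# ⊎ b ≈ 0#) where

    ^≈0⇒≈0 : ∀ k y → y ^ suc k ≈ 0# → y ≈ 0#
    ^≈0⇒≈0 zero    y y≈0 with domain y 1# y≈0
    ... | inj₁ y≈0′ = y≈0′
    ... | inj₂ 1≈0  = trans (sym (*-identityʳ y)) (trans (*-congˡ 1≈0) (zeroʳ y))
    ^≈0⇒≈0 (suc k) y y≈0 with domain y (y ^ suc k) y≈0
    ... | inj₁ y≈0′ = y≈0′
    ... | inj₂ yᵏ≈0 = ^≈0⇒≈0 k y yᵏ≈0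

    roots-of-factorisation : ∀ {p : Carrier → Carrier} k j α β →
      (∀ x → p x ≈ x ^ suc k * ((x + α) * (x + β) ^ suc j)) →
      ∀ x → (p x ≈ 0#) ⇔ (x ≈ 0# ⊎ x ≈ - β ⊎ x ≈ - α)
    roots-of-factorisation {p} k j α β factorisation x =
      mk⇔ (λ p≈0 → to (trans (sym (factorisation x)) p≈0)) (λ root → trans (factorisation x) (from root))
      where
      root : ∀ γ → x + γ ≈ 0# → x ≈ - γ
      root γ = inverseˡ-unique x γ
      vanish : ∀ γ → x ≈ - γ → x + γ ≈ 0#
      vanish γ x≈-γ = trans (+-congʳ x≈-γ) (-‿inverseˡ γ)
      ^-vanish : ∀ e y → y ≈ 0# → y ^ suc e ≈ 0#
      ^-vanish e y y≈0 = trans (*-congʳ y≈0) (zeroˡ _)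
      to : x ^ suc k * ((x + α) * (x + β) ^ suc j) ≈ 0# → x ≈ 0# ⊎ x ≈ - β ⊎ x ≈ - α
      to p≈0 with domain (x ^ suc k) _ p≈0
      ... | inj₁ xᵏ≈0 = inj₁ (^≈0⇒≈0 k x xᵏ≈0)
      ... | inj₂ q≈0 with domain (x + α) _ q≈0
      ...   | inj₁ x+α≈0 = inj₂ (inj₂ (root α x+α≈0))
      ...   | inj₂ x+βʲ≈0 = inj₂ (inj₁ (root β (^≈0⇒≈0 j (x + β) x+βʲ≈0)))
      from : x ≈ 0# ⊎ x ≈ - β ⊎ x ≈ - α → x ^ suc k * ((x + α) * (x + β) ^ suc j) ≈ 0#
      from (inj₁ x≈0) = trans (*-congʳ (^-vanish k x x≈0)) (zeroˡ _)
      from (inj₂ (inj₁ x≈-β)) =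
        trans (*-congˡ (trans (*-congˡ (^-vanish j (x + β) (vanish β x≈-β))) (zeroʳ _))) (zeroʳ _)
      from (inj₂ (inj₂ x≈-α)) =
        trans (*-congˡ (trans (*-congʳ (vanish α x≈-α)) (zeroˡ _))) (zeroʳ _)

  private
    κ : ℕ → Carrier
    κ a = a ×′ 1#

    ι≈κ : ∀ a → ι R a ≈ κ a
    ι≈κ a = ×ᵤ≈× a 1#

    ι-^ : ∀ n e → ι R (n ^ℕ e) ≈ ι R n ^ e
    ι-^ n zero    = +-identityʳ 1#
    ι-^ n (suc e) = trans (×1-homo-* n (n ^ℕ e)) (*-congˡ (ι-^ n e))

    constant-term : ∀ {a} b y → a ≡ b → a · y ≈ κ b * y
    constant-term b y ≡.refl = trans (·≈ι* b y) (*-congʳ (ι≈κ b))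

    term : ∀ {a} n e b y → a ≡ n ^ℕ e *ℕ b → a · y ≈ (ι R n ^ e * κ b) * y
    term n e b y ≡.refl =
      trans (·≈ι* (n ^ℕ e *ℕ b) y) (*-congʳ (trans (×1-homo-* (n ^ℕ e) b) (*-cong (ι-^ n e) (ι≈κ b))))

  quadratic : ∀ s x → s 0 ≡ 6 → s 1 ≡ 5 → s 2 ≡ 1 → evalPoly R s 2 x ≈ (x + ι R 3) * (x + ι R 2) ^ 1
  quadratic s x s₀ s₁ s₂ = begin
    evalPoly R s 2 x
      ≈⟨ +-cong (+-cong (constant-term 6 _ s₀) (constant-term 5 _ s₁)) (constant-term 1 _ s₂) ⟩
    (κ 6 * x ^ 0 + κ 5 * x ^ 1) + κ 1 * x ^ 2
      ≈⟨ solve 1 (λ x → (con 6 :* x :^ 0 :+ con 5 :* x :^ 1) :+ con 1 :* x :^ 2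
                      := (x :+ con 3) :* (x :+ con 2) :^ 1) refl x ⟩
    (x + κ 3) * (x + κ 2) ^ 1
      ≈⟨ *-cong (+-congˡ (ι≈κ 3)) (^-congˡ 1 (+-congˡ (ι≈κ 2))) ⟨
    (x + ι R 3) * (x + ι R 2) ^ 1 ∎

  quartic : ∀ s n x →
    s 0 ≡ n ^ℕ 4 *ℕ 2 → s 1 ≡ n ^ℕ 3 *ℕ 7 → s 2 ≡ n ^ℕ 2 *ℕ 9 → s 3 ≡ n ^ℕ 1 *ℕ 5 → s 4 ≡ n ^ℕ 0 *ℕ 1 →
    evalPoly R s 4 x ≈ (x + ι R (2 *ℕ n)) * (x + ι R n) ^ 3
  quartic s n x s₀ s₁ s₂ s₃ s₄ = begin
    evalPoly R s 4 x
      ≈⟨ +-cong (+-cong (+-cong (+-cong (term n 4 2 _ s₀) (term n 3 7 _ s₁)) (term n 2 9 _ s₂)) (term n 1 5 _ s₃))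
                (term n 0 1 _ s₄) ⟩
    (((((μ ^ 4 * κ 2) * x ^ 0 + (μ ^ 3 * κ 7) * x ^ 1) + (μ ^ 2 * κ 9) * x ^ 2) + (μ ^ 1 * κ 5) * x ^ 3)
      + (μ ^ 0 * κ 1) * x ^ 4)
      ≈⟨ solve 2 (λ x μ → ((((μ :^ 4 :* con 2) :* x :^ 0 :+ (μ :^ 3 :* con 7) :* x :^ 1) :+ (μ :^ 2 :* con 9) :* x :^ 2)
                            :+ (μ :^ 1 :* con 5) :* x :^ 3) :+ (μ :^ 0 :* con 1) :* x :^ 4
                         := (x :+ con 2 :* μ) :* (x :+ μ) :^ 3) refl x μ ⟩
    (x + κ 2 * μ) * (x + μ) ^ 3
      ≈⟨ *-congʳ (+-congˡ (trans (×1-homo-* 2 n) (*-congʳ (ι≈κ 2)))) ⟨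
    (x + ι R (2 *ℕ n)) * (x + μ) ^ 3 ∎
    where
    μ : Carrier
    μ = ι R n

open import Defs
open ElementarySymmetric
open Labelling
open NonCommutingGraph
open PartSizes
open import Algebra.Bundles using (CommutativeRing)
open import Data.Bool using (true)
open import Data.Fin using (Fin; zero; suc)
open import Data.Fin.Subset using (Subset)
open import Data.Fin.Subset.Properties using (anySubset?)
open import Data.List using (length)
open import Data.List.Relation.Unary.Unique.Propositional using (Unique)
open import Data.Nat using (ℕ; suc; pred; _+_; _*_; _^_; _∸_; _≤_; _<_; s≤s; z≤n; NonZero)
open import Data.Nat.Properties using (≤-trans; *-monoʳ-≤; *-identityʳ; *-suc; suc-pred)
open import Data.Product using (_×_; _,_)
open import Function using (_∘_; const)
open import Function.Bundles using (_⇔_; mk⇔)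
open import Function.Construct.Composition using (_⇔-∘_)
open import Level using (Level)
open import Relation.Binary.PropositionalEquality as ≡ using (_≡_; refl)
open import Relation.Nullary using (¬?)
open import Relation.Nullary.Decidable using (False; toWitnessFalse; decidable-stable; _×-dec_; _→-dec_)
open import Relation.Unary using (Decidable)

∀-Subset : ∀ {m} {P : Subset m → Set} (P? : Decidable P) → False (anySubset? (¬? ∘ P?)) → ∀ W → P W
∀-Subset P? none W = decidable-stable (P? W) (λ ¬PW → toWitnessFalse none (W , ¬PW))

coefficient : ∀ n .{{_ : NonZero n}} {k} (label : U n → Fin k) →
  (∀ W → Resolving n W ⇔ Labelled.DistinctLabelsOutside label (vertices n) W) →
  ∀ i {c} → NumResolvingSets n i c → i ≤ N n →
  c ≡ esym (const true) (Labelled.labelCount label (vertices n)) (N n ∸ i)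
coefficient n label resolving⇔distinct i (L , L! , L⇔ , length-L) i≤N =
  ≡.trans (≡.sym length-L) length-L≡
  where
  length-L≡ : length L ≡ esym (const true) (Labelled.labelCount label (vertices n)) (N n ∸ i)
  length-L≡ =
    Labelled.length-subsets-of-size label (vertices n) {P = Resolving n} resolving⇔distinct {i = i} L L! L⇔ i≤N

mergeSingletons : Fin 4 → Fin 2
mergeSingletons zero    = zero
mergeSingletons (suc _) = suc zero

module SmallestCase {c ℓ : Level} (R : CommutativeRing c ℓ) where
  open CommutativeRing R using (trans; *-congˡ)
  open Polynomial R
  open Group 1
  module L₁ = Labelled (mergeSingletons ∘ part)

  resolving⇔distinct : ∀ W → Resolving 1 W ⇔ L₁.DistinctLabelsOutside (vertices 1) W
  resolving⇔distinct W = agreement W ⇔-∘ resolving⇔resolves W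
    where
    agreement : ∀ W → Resolves (vertices 1) W ⇔ L₁.DistinctLabelsOutside (vertices 1) W
    agreement W = let to , from = ∀-Subset agree? _ W in mk⇔ to from
      where
      agree? : Decidable λ W → (Resolves (vertices 1) W → L₁.DistinctLabelsOutside (vertices 1) W)
                             × (L₁.DistinctLabelsOutside (vertices 1) W → Resolves (vertices 1) W)
      agree? W = (resolves? (vertices 1) W →-dec L₁.distinctLabelsOutside? (vertices 1) W)
           ×-dec (L₁.distinctLabelsOutside? (vertices 1) W →-dec resolves? (vertices 1) W)

  smallest-case : IsCharZeroDomain R → (r : ℕ → ℕ) → (∀ i → NumResolvingSets 1 i (r i)) →
                  RootsAre R (evalPoly R r (N 1)) 2 3
  smallest-case (_ , domain , _) r counts =
    roots-of-factorisation domain 2 0 (ι R 3) (ι R 2) λ x →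
      trans (evalPoly-complementary-esym (L₁.labelCount (vertices 1)) 2 r
               (λ i i≤N → coefficient 1 (mergeSingletons ∘ part) resolving⇔distinct i (counts i) i≤N) x)
            (*-congˡ (quadratic (λ j → esym (const true) (L₁.labelCount (vertices 1)) (2 ∸ j)) x refl refl refl))

partShape-positive : ∀ q → 1 ≤ partShape q
partShape-positive zero    = s≤s z≤n
partShape-positive (suc _) = s≤s z≤n

module LargeCase {c ℓ : Level} (R : CommutativeRing c ℓ) (n : ℕ) .{{_ : NonZero n}} where
  open CommutativeRing R using (trans; *-congˡ; reflexive)
  open Polynomial R
  open Labelled

  open Group n
  open Sizes n

  resolving⇔distinct : 1 < n → ∀ W → Resolving n W ⇔ DistinctLabelsOutside part (vertices n) W
  resolving⇔distinct 1<n W = resolves⇔distinct′ ⇔-∘ resolving⇔resolves′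
    where
    vertices! : Unique (vertices n)
    vertices! = vertices-unique
    parts-≥2 : ∀ q → 2 ≤ labelCount part (vertices n) q
    parts-≥2 q = ≡.subst (2 ≤_) (≡.sym (labelCount-vertices q))
      (≤-trans 1<n (≡.subst (_≤ n * partShape q) (*-identityʳ n) (*-monoʳ-≤ n (partShape-positive q))))
    resolves⇔distinct′ : Resolves (vertices n) W ⇔ DistinctLabelsOutside part (vertices n) W
    resolves⇔distinct′ = resolves⇔distinct vertices! W parts-≥2
    resolving⇔resolves′ : Resolving n W ⇔ Resolves (vertices n) W
    resolving⇔resolves′ = resolving⇔resolves W

  large-case : 1 < n → IsCharZeroDomain R → (r : ℕ → ℕ) → (∀ i → NumResolvingSets n i (r i)) →
               RootsAre R (evalPoly R r (N n)) n (2 * n)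
  large-case 1<n (_ , domain , _) r counts =
    roots-of-factorisation domain m 2 (ι R (2 * n)) (ι R n) λ x →
      trans (reflexive (≡.cong (λ M → evalPoly R r M x) size))
        (trans (evalPoly-complementary-esym (labelCount part (vertices n)) m r coefficient′ x)
               (*-congˡ (quartic (λ j → esym (const true) (labelCount part (vertices n)) (4 ∸ j)) n x
                                 (scaled 0) (scaled 1) (scaled 2) (scaled 3) (scaled 4))))
    where
    m : ℕ
    m = 5 * pred n
    size : N n ≡ 4 + suc m
    size = ≡.trans vertex-count (≡.trans (≡.cong (5 *_) (≡.sym (suc-pred n))) (*-suc 5 (pred n)))
    coefficient′ : ∀ i → i ≤ 4 + suc m → r i ≡ esym (const true) (labelCount part (vertices n)) (4 + suc m ∸ i)
    coefficient′ i i≤ = ≡.subst (λ M → r i ≡ esym (const true) (labelCount part (vertices n)) (M ∸ i)) size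
      (coefficient n part (resolving⇔distinct 1<n) i (counts i) (≡.subst (i ≤_) (≡.sym size) i≤))
    scaled : ∀ j → esym (const true) (labelCount part (vertices n)) (4 ∸ j) ≡
                   n ^ (4 ∸ j) * esym (const true) partShape (4 ∸ j)
    scaled j = ≡.trans (esym-cong (const true) labelCount-vertices (4 ∸ j))
                       (esym-scale (const true) partShape n (4 ∸ j))

corollary3p4 : (n : ℕ) .{{_ : NonZero n}} {c ℓ : Level} (R : CommutativeRing c ℓ) →
    IsCharZeroDomain R →
    (r : ℕ → ℕ) → (∀ i → NumResolvingSets n i (r i)) →
    (n ≡ 1 → RootsAre R (evalPoly R r (N n)) 2 3) ×
    (1 < n → RootsAre R (evalPoly R r (N n)) n (2 * n))
corollary3p4 n R domain r counts =
  (λ { refl → SmallestCase.smallest-case R domain r counts }) ,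
  (λ 1<n → LargeCase.large-case R n 1<n domain r counts)
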